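{- Let $a<b$ be positive integers and suppose there exists a nonnegative integer $c$ such that every odd integer $u\geqslant 2c+1$ is a term of $\mathcal{V}(a,b)$. Then $\mathcal{V}(a,b)=\mathcal{V}(1,2)$ or $\mathcal{V}(a,b)=\mathcal{V}(1,3)$.
   Context: For positive integers $a<b$, the sequence $\mathcal{V}(a,b)=(a_m)_{m\geqslant 1}$ is defined greedily by $a_1=a$, $a_2=b$, and, for $m\geqslant 2$, $a_{m+1}$ is the smallest integer larger than $a_m$ that can be written as $a_i+a_j$ with $i\leqslant j\leqslant m$ (the two earlier terms not necessarily distinct) in exactly one way (representations are unordered pairs). -}

module Defs where

open import Data.Nat using (ℕ; zero; suc; _+_; _*_; _≤_; _<_)
open import Data.Product using (Σ; _×_; _,_; ∃; ∃-syntax)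
open import Relation.Binary.PropositionalEquality using (_≡_)
open import Relation.Nullary using (¬_)

-- Sequences are indexed from 0: s 0 = a₁, s 1 = a₂, ..., i.e. s k = a_{k+1}.

IsRep : (ℕ → ℕ) → ℕ → ℕ → ℕ → ℕ → Set
IsRep s m n i j = (i ≤ j) × (j ≤ m) × (s i + s j ≡ n)

UniqueRep : (ℕ → ℕ) → ℕ → ℕ → Set
UniqueRep s m n =
  Σ ℕ λ i → Σ ℕ λ j → IsRep s m n i j ×
    (∀ i' j' → IsRep s m n i' j' → (i' ≡ i) × (j' ≡ j))

IsV : ℕ → ℕ → (ℕ → ℕ) → Set
IsV a b s =
  (s 0 ≡ a) × (s 1 ≡ b) ×
  (∀ m → 1 ≤ m →
     (s m < s (suc m)) ×
     UniqueRep s m (s (suc m)) ×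
     (∀ n → s m < n → n < s (suc m) → ¬ UniqueRep s m n))

IsTerm : (ℕ → ℕ) → ℕ → Set
IsTerm s u = ∃[ k ] (s k ≡ u)

{-# OPTIONS --safe #-}
-- Once every odd number beyond 2c + 1 is a term, there is at most one even term e: two even
-- terms x + x and y + y would give the odd term 2c + 1 + 2(x + y + b) two representations as
-- an odd term plus an even term. Every later odd term is then e plus an earlier odd term, so
-- all odd terms lie in a + eℕ or b + eℕ, and three consecutive odd terms force e ∣ 4. The
-- term a is odd, as otherwise b + b would be a second even term. If b is even then e = b ∣ 2,
-- so (a, b) = (1, 2); if b is odd the third term a + b, 2a or 2b is the even one, and
-- b < e ≤ 4 gives (a, b) = (1, 3). The greedy sequence is determined by (a, b).
module Submission where

open import Defs
open import Data.Nat using (ℕ; zero; suc; _+_; _*_; _≤_; _<_; _≤?_; z≤n; s≤s; parity)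
open import Data.Nat.Properties
open import Data.Nat.Divisibility using (_∣_; divides; ∣⇒≤; ∣-trans; ∣m+n∣m⇒∣n; n∣m*n)
open import Data.Nat.Induction using (<-rec)
open import Data.Nat.Tactic.RingSolver using (solve)
open import Data.List using (_∷_; [])
open import Data.Parity.Base using (0ℙ; 1ℙ)
import Data.Parity.Properties as ℙ
open import Data.Product using (∃-syntax; _×_; _,_; proj₁; proj₂; swap)
open import Data.Sum as Sum using (_⊎_; inj₁; inj₂)
open import Function using (_∘_)
open import Relation.Nullary using (¬_; yes; no; contradiction)
open import Relation.Binary.PropositionalEquality

parity-double : ∀ n → parity (n + n) ≡ 0ℙ
parity-double n rewrite ℙ.+-homo-+ n n = ℙ.p+p≡0ℙ (parity n)

parity-2c+1+2d : ∀ c d → parity (2 * c + 1 + 2 * d) ≡ 1ℙ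
parity-2c+1+2d c d
  rewrite ℙ.+-homo-+ (2 * c + 1) (2 * d) | ℙ.+-homo-+ (2 * c) 1
        | ℙ.*-homo-* 2 c | ℙ.*-homo-* 2 d = refl

parity≡0ℙ⇒double : ∀ n → parity n ≡ 0ℙ → ∃[ h ] (n ≡ h + h)
parity≡0ℙ⇒double zero          _  = 0 , refl
parity≡0ℙ⇒double (suc (suc n)) p with parity≡0ℙ⇒double n p
... | h , refl = suc h , cong suc (sym (+-suc h h))

parity-+≡0ℙ : ∀ m n → parity (m + n) ≡ 0ℙ → parity m ≡ parity n
parity-+≡0ℙ m n p with parity m | parity n | ℙ.+-homo-+ m n
... | 0ℙ | 0ℙ | _ = refl
... | 1ℙ | 1ℙ | _ = refl
... | 0ℙ | 1ℙ | q = contradiction (trans (sym p) q) λ ()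
... | 1ℙ | 0ℙ | q = contradiction (trans (sym p) q) λ ()

parity-+-same : ∀ m n → parity m ≡ parity n → parity (m + n) ≡ 0ℙ
parity-+-same m n p rewrite ℙ.+-homo-+ m n | p = ℙ.p+p≡0ℙ (parity n)

parity-+≡1ℙ : ∀ m n → parity (m + n) ≡ 1ℙ →
  (parity m ≡ 0ℙ × parity n ≡ 1ℙ) ⊎ (parity m ≡ 1ℙ × parity n ≡ 0ℙ)
parity-+≡1ℙ m n p with parity m | parity n | ℙ.+-homo-+ m n
... | 0ℙ | 1ℙ | _ = inj₁ (refl , refl)
... | 1ℙ | 0ℙ | _ = inj₂ (refl , refl)
... | 0ℙ | 0ℙ | q = contradiction (trans (sym p) q) λ ()
... | 1ℙ | 1ℙ | q = contradiction (trans (sym p) q) λ ()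

x+y≡n+n⇒x≡n : ∀ {x y n} → n ≤ x → n ≤ y → x + y ≡ n + n → x ≡ n
x+y≡n+n⇒x≡n n≤x n≤y sum = ≤-antisym (≮⇒≥ (λ n<x → <⇒≢ (+-mono-<-≤ n<x n≤y) (sym sum))) n≤x

0<a<b≤2 : ∀ {a b} → 0 < a → a < b → b ≤ 2 → a ≡ 1 × b ≡ 2
0<a<b≤2 0<a a<b b≤2 =
  ≤-antisym (≤-pred (<-≤-trans a<b b≤2)) 0<a , ≤-antisym b≤2 (<-≤-trans (s≤s 0<a) a<b)

odd-0<a<b≤3 : ∀ {a b} → 0 < a → a < b → b ≤ 3 → parity a ≡ 1ℙ → parity b ≡ 1ℙ → a ≡ 1 × b ≡ 3
odd-0<a<b≤3 {1} {1} _ (s≤s ()) _ _ _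
odd-0<a<b≤3 {1} {2} _ _ _ _ ()
odd-0<a<b≤3 {1} {3} _ _ _ _ _ = refl , refl
odd-0<a<b≤3 {1} {suc (suc (suc (suc _)))} _ _ (s≤s (s≤s (s≤s ()))) _ _
odd-0<a<b≤3 {2} _ _ _ () _
odd-0<a<b≤3 {suc (suc (suc _))} _ a<b b≤3 _ _ with <-≤-trans a<b b≤3
... | s≤s (s≤s (s≤s ()))

OnProgression : ℕ → ℕ → ℕ → Set
OnProgression x e u = ∃[ k ] (u ≡ x + k * e)

OnProgression-start : ∀ x e → OnProgression x e x
OnProgression-start x e = 0 , sym (+-identityʳ x)

OnProgression-step : ∀ {x e u} → OnProgression x e u → OnProgression x e (e + u)
OnProgression-step {x} {e} (k , refl) = suc k , solve (x ∷ e ∷ k ∷ [])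

OnProgression-∣ : ∀ {x e u v d} → OnProgression x e u → OnProgression x e v →
  v ≡ u + d → e ∣ d
OnProgression-∣ {x} {e} {d = d} (k , refl) (l , refl) v≡u+d =
  ∣m+n∣m⇒∣n (subst (e ∣_) kl (n∣m*n l)) (n∣m*n k)
  where
  kl : l * e ≡ k * e + d
  kl = +-cancelˡ-≡ x _ _ (trans v≡u+d (+-assoc x (k * e) d))

OnProgression-parity : ∀ {x e u} → parity x ≡ 0ℙ → parity e ≡ 0ℙ →
  OnProgression x e u → parity u ≡ 0ℙ
OnProgression-parity {x} {e} px pe (k , refl)
  rewrite ℙ.+-homo-+ x (k * e) | ℙ.*-homo-* k e | px | pe = ℙ.*-zeroʳ (parity k)

-- Two of u, u + 2, u + 4 lie on the same progression, and differ by 2 or 4.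
OnProgressions-∣4 : ∀ {x y e} u →
  (∀ d → OnProgression x e (u + 2 * d) ⊎ OnProgression y e (u + 2 * d)) → e ∣ 4
OnProgressions-∣4 {x} {y} {e} u tail = pigeonhole (tail 0) (tail 1) (tail 2)
  where
  Cl : ℕ → Set
  Cl v = OnProgression x e v ⊎ OnProgression y e v

  0→1 : u + 2 ≡ u + 0 + 2
  0→1 = cong (_+ 2) (sym (+-identityʳ u))
  0→2 : u + 4 ≡ u + 0 + 4
  0→2 = cong (_+ 4) (sym (+-identityʳ u))
  1→2 : u + 4 ≡ u + 2 + 2
  1→2 = sym (+-assoc u 2 2)
  2∣4 : 2 ∣ 4
  2∣4 = divides 2 refl

  pigeonhole : Cl (u + 0) → Cl (u + 2) → Cl (u + 4) → e ∣ 4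
  pigeonhole (inj₁ p) (inj₁ q) _        = ∣-trans (OnProgression-∣ p q 0→1) 2∣4
  pigeonhole (inj₂ p) (inj₂ q) _        = ∣-trans (OnProgression-∣ p q 0→1) 2∣4
  pigeonhole (inj₁ p) (inj₂ _) (inj₁ r) = OnProgression-∣ p r 0→2
  pigeonhole (inj₂ p) (inj₁ _) (inj₂ r) = OnProgression-∣ p r 0→2
  pigeonhole (inj₁ _) (inj₂ q) (inj₂ r) = ∣-trans (OnProgression-∣ q r 1→2) 2∣4
  pigeonhole (inj₂ _) (inj₁ q) (inj₁ r) = ∣-trans (OnProgression-∣ q r 1→2) 2∣4

UniqueRep-cong : ∀ {u v m n} → (∀ i → i ≤ m → u i ≡ v i) → UniqueRep u m n → UniqueRep v m n
UniqueRep-cong {u} {v} {m} u≗v (i , j , (i≤j , j≤m , sum) , unique) =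
  i , j , (i≤j , j≤m , trans (sym (agree i≤j j≤m)) sum) ,
  λ i' j' (i'≤j' , j'≤m , sum') → unique i' j' (i'≤j' , j'≤m , trans (agree i'≤j' j'≤m) sum')
  where
  agree : ∀ {i j} → i ≤ j → j ≤ m → u i + u j ≡ v i + v j
  agree {i} {j} i≤j j≤m = cong₂ _+_ (u≗v i (≤-trans i≤j j≤m)) (u≗v j j≤m)

UniqueRep-canonical : ∀ {s m n p q} (r : UniqueRep s m n) → s p + s q ≡ n → p ≤ m → q ≤ m →
  (p ≡ proj₁ r × q ≡ proj₁ (proj₂ r)) ⊎ (p ≡ proj₁ (proj₂ r) × q ≡ proj₁ r)
UniqueRep-canonical {s} {p = p} {q} (_ , _ , _ , unique) sum p≤m q≤m with ≤-total p q
... | inj₁ p≤q = inj₁ (unique p q (p≤q , q≤m , sum))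
... | inj₂ q≤p = inj₂ (swap (unique q p (q≤p , p≤m , trans (+-comm (s q) (s p)) sum)))

UniqueRep-unordered : ∀ {s m n p q p' q'} → UniqueRep s m n →
  s p + s q ≡ n → p ≤ m → q ≤ m → s p' + s q' ≡ n → p' ≤ m → q' ≤ m →
  (p ≡ p' × q ≡ q') ⊎ (p ≡ q' × q ≡ p')
UniqueRep-unordered {s} r sum p≤m q≤m sum' p'≤m q'≤m
  with UniqueRep-canonical {s} r sum p≤m q≤m | UniqueRep-canonical {s} r sum' p'≤m q'≤m
... | inj₁ (p≡i , q≡j) | inj₁ (p'≡i , q'≡j) = inj₁ (trans p≡i (sym p'≡i) , trans q≡j (sym q'≡j))
... | inj₁ (p≡i , q≡j) | inj₂ (p'≡j , q'≡i) = inj₂ (trans p≡i (sym q'≡i) , trans q≡j (sym p'≡j))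
... | inj₂ (p≡j , q≡i) | inj₁ (p'≡i , q'≡j) = inj₂ (trans p≡j (sym q'≡j) , trans q≡i (sym p'≡i))
... | inj₂ (p≡j , q≡i) | inj₂ (p'≡j , q'≡i) = inj₁ (trans p≡j (sym p'≡j) , trans q≡i (sym q'≡i))

module StrictlyIncreasing {s : ℕ → ℕ} (increasing : ∀ n → s n < s (suc n)) where

  strictMono : ∀ {i j} → i < j → s i < s j
  strictMono {i} {suc j} (s≤s i≤j) with m≤n⇒m<n∨m≡n i≤j
  ... | inj₁ i<j  = <-trans (strictMono i<j) (increasing j)
  ... | inj₂ refl = increasing i

  mono-≤ : ∀ {i j} → i ≤ j → s i ≤ s j
  mono-≤ i≤j with m≤n⇒m<n∨m≡n i≤j
  ... | inj₁ i<j  = <⇒≤ (strictMono i<j)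
  ... | inj₂ refl = ≤-refl

  cancel-< : ∀ {i j} → s i < s j → i < j
  cancel-< si<sj = ≰⇒> (λ j≤i → <⇒≱ si<sj (mono-≤ j≤i))

  injective : ∀ {i j} → s i ≡ s j → i ≡ j
  injective si≡sj = ≤-antisym (≮⇒≥ (λ j<i → <⇒≢ (strictMono j<i) (sym si≡sj)))
                              (≮⇒≥ (λ i<j → <⇒≢ (strictMono i<j) si≡sj))

  n≤s : ∀ n → n ≤ s n
  n≤s zero    = z≤n
  n≤s (suc n) = ≤-trans (s≤s (n≤s n)) (increasing n)

  crossing : ∀ {X} n → s n < X → ∃[ m ] (n ≤ m × s m < X × X ≤ s (suc m))
  crossing {X} n sn<X = go X n ≤-refl sn<X (≤-trans (m≤m+n X n) (n≤s (X + n)))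
    where
    go : ∀ d k → n ≤ k → s k < X → X ≤ s (d + k) → ∃[ m ] (n ≤ m × s m < X × X ≤ s (suc m))
    go zero    k _   sk<X X≤sk = contradiction sk<X (≤⇒≯ X≤sk)
    go (suc d) k n≤k sk<X X≤s with X ≤? s (suc k)
    ... | yes X≤sk+1 = k , n≤k , sk<X , X≤sk+1
    ... | no  X≰sk+1 =
      go d (suc k) (m≤n⇒m≤1+n n≤k) (≰⇒> X≰sk+1) (subst (λ i → X ≤ s i) (sym (+-suc d k)) X≤s)

IsV-next-≮ : ∀ {a b u v m} → IsV a b u → IsV a b v → 1 ≤ m →
  (∀ i → i ≤ m → u i ≡ v i) → ¬ u (suc m) < v (suc m)
IsV-next-≮ {u = u} {v} {m} hu hv 1≤m u≗v uₘ₊₁<vₘ₊₁ =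
  minimalᵥ (u (suc m)) (subst (_< u (suc m)) (u≗v m ≤-refl) increasingᵤ) uₘ₊₁<vₘ₊₁
           (UniqueRep-cong u≗v repᵤ)
  where
  increasingᵤ = proj₁ (proj₂ (proj₂ hu) m 1≤m)
  repᵤ = proj₁ (proj₂ (proj₂ (proj₂ hu) m 1≤m))
  minimalᵥ = proj₂ (proj₂ (proj₂ (proj₂ hv) m 1≤m))

IsV-unique : ∀ {a b s t} → IsV a b s → IsV a b t → ∀ m → s m ≡ t m
IsV-unique {s = s} {t} hs ht = <-rec (λ m → s m ≡ t m) agree
  where
  agree : ∀ m → (∀ {i} → i < m → s i ≡ t i) → s m ≡ t m
  agree zero          _  = trans (proj₁ hs) (sym (proj₁ ht))
  agree (suc zero)    _  = trans (proj₁ (proj₂ hs)) (sym (proj₁ (proj₂ ht)))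
  agree (suc (suc m)) ih = ≤-antisym (≮⇒≥ (IsV-next-≮ ht hs (s≤s z≤n) (λ i → sym ∘ s≗t i)))
                                     (≮⇒≥ (IsV-next-≮ hs ht (s≤s z≤n) s≗t))
    where
    s≗t : ∀ i → i ≤ suc m → s i ≡ t i
    s≗t i i≤m+1 = ih (s≤s i≤m+1)

module VSequence {a b : ℕ} {s : ℕ → ℕ} (0<a : 0 < a) (a<b : a < b) (hs : IsV a b s) where

  s0≡a : s 0 ≡ a
  s0≡a = proj₁ hs

  s1≡b : s 1 ≡ b
  s1≡b = proj₁ (proj₂ hs)

  termRep : ∀ m → 1 ≤ m → UniqueRep s m (s (suc m))
  termRep m 1≤m = proj₁ (proj₂ (proj₂ (proj₂ hs) m 1≤m))

  termMinimal : ∀ m → 1 ≤ m → ∀ n → s m < n → n < s (suc m) → ¬ UniqueRep s m n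
  termMinimal m 1≤m = proj₂ (proj₂ (proj₂ (proj₂ hs) m 1≤m))

  increasing : ∀ n → s n < s (suc n)
  increasing zero    = subst₂ _<_ (sym s0≡a) (sym s1≡b) a<b
  increasing (suc n) = proj₁ (proj₂ (proj₂ hs) (suc n) (s≤s z≤n))

  open StrictlyIncreasing increasing public

  positive : ∀ n → 0 < s n
  positive n = <-≤-trans 0<a (subst (_≤ s n) s0≡a (mono-≤ z≤n))

  above-b⇒index≥2 : ∀ k → b < s k → ∃[ m ] (1 ≤ m × k ≡ suc m)
  above-b⇒index≥2 zero          b<sk = contradiction (subst (b <_) s0≡a b<sk) (<⇒≯ a<b)
  above-b⇒index≥2 (suc zero)    b<sk = contradiction (subst (b <_) s1≡b b<sk) (<-irrefl refl)
  above-b⇒index≥2 (suc (suc m)) _    = suc m , s≤s z≤n , refl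

  summand-index : ∀ {p q m} → s p + s q ≡ s (suc m) → p ≤ m
  summand-index {p} {q} sum = ≤-pred (cancel-< (subst (s p <_) sum (m<m+n (s p) (positive q))))

  term-sum-unordered : ∀ {m p q p' q'} → 1 ≤ m →
    s p + s q ≡ s (suc m) → s p' + s q' ≡ s (suc m) → (p ≡ p' × q ≡ q') ⊎ (p ≡ q' × q ≡ p')
  term-sum-unordered {m} {p} {q} {p'} {q'} 1≤m sum sum' =
    UniqueRep-unordered {s} (termRep m 1≤m)
      sum  (summand-index sum)  (summand-index (trans (+-comm (s q) (s p)) sum))
      sum' (summand-index sum') (summand-index (trans (+-comm (s q') (s p')) sum'))

  odd-terms-on-progressions : ∀ {e} → (∀ i → parity (s i) ≡ 0ℙ → s i ≡ e) →
    ∀ n → parity (s n) ≡ 1ℙ → OnProgression a e (s n) ⊎ OnProgression b e (s n)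
  odd-terms-on-progressions {e} evens = <-rec P onProgression
    where
    Cl : ℕ → Set
    Cl u = OnProgression a e u ⊎ OnProgression b e u

    P : ℕ → Set
    P n = parity (s n) ≡ 1ℙ → Cl (s n)

    Cl-step : ∀ {u} → Cl u → Cl (e + u)
    Cl-step = Sum.map OnProgression-step OnProgression-step

    onProgression : ∀ n → (∀ {i} → i < n → P i) → P n
    onProgression zero          _  _ =
      inj₁ (subst (OnProgression a e) (sym s0≡a) (OnProgression-start a e))
    onProgression (suc zero)    _  _ =
      inj₂ (subst (OnProgression b e) (sym s1≡b) (OnProgression-start b e))
    onProgression (suc (suc m)) ih odd with termRep (suc m) (s≤s z≤n)
    ... | i , j , (i≤j , j≤m , sum) , _
      with parity-+≡1ℙ (s i) (s j) (trans (cong parity sum) odd)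
    ... | inj₁ (even-i , odd-j) =
      subst Cl sum (subst (λ x → Cl (x + s j)) (sym (evens i even-i))
        (Cl-step (ih (s≤s j≤m) odd-j)))
    ... | inj₂ (odd-i , even-j) =
      subst Cl (trans (+-comm (s j) (s i)) sum) (subst (λ x → Cl (x + s i)) (sym (evens j even-j))
        (Cl-step (ih (s≤s (≤-trans i≤j j≤m)) odd-i)))

  module OddTail (c : ℕ) (hc : ∀ k → 2 * c + 1 ≤ 2 * k + 1 → IsTerm s (2 * k + 1)) where

    oddTerm : ∀ d → IsTerm s (2 * c + 1 + 2 * d)
    oddTerm d = subst (IsTerm s) shift (hc (c + d) (+-monoˡ-≤ 1 (*-monoʳ-≤ 2 (m≤m+n c d))))
      where
      shift : 2 * (c + d) + 1 ≡ 2 * c + 1 + 2 * d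
      shift = solve (c ∷ d ∷ [])

    n<2c+1+2n : ∀ n → n < 2 * c + 1 + 2 * n
    n<2c+1+2n n = subst (n <_) regroup (s≤s (m≤m+n n (2 * c + n)))
      where
      regroup : suc (n + (2 * c + n)) ≡ 2 * c + 1 + 2 * n
      regroup = solve (c ∷ n ∷ [])

    double-split : ∀ x y → 2 * c + 1 + 2 * (y + b) + (x + x) ≡ 2 * c + 1 + 2 * (x + y + b)
    double-split x y = solve (c ∷ b ∷ x ∷ y ∷ [])

    double-split′ : ∀ x y → 2 * c + 1 + 2 * (x + b) + (y + y) ≡ 2 * c + 1 + 2 * (x + y + b)
    double-split′ x y = solve (c ∷ b ∷ x ∷ y ∷ [])

    even-terms-equal : ∀ p q → parity (s p) ≡ 0ℙ → parity (s q) ≡ 0ℙ → s p ≡ s q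
    even-terms-equal p q even-p even-q
      with parity≡0ℙ⇒double (s p) even-p | parity≡0ℙ⇒double (s q) even-q
    ... | x , sp≡x+x | y , sq≡y+y
      with oddTerm (x + y + b) | oddTerm (y + b) | oddTerm (x + b)
    ... | k , sk≡N | p' , sp'≡ | q' , sq'≡
      with above-b⇒index≥2 k
             (subst (b <_) (sym sk≡N) (≤-<-trans (m≤n+m b (x + y)) (n<2c+1+2n (x + y + b))))
    ... | m , 1≤m , refl
      with term-sum-unordered 1≤m
             (trans (cong₂ _+_ sp'≡ sp≡x+x) (trans (double-split x y) (sym sk≡N)))
             (trans (cong₂ _+_ sq'≡ sq≡y+y) (trans (double-split′ x y) (sym sk≡N)))
    ... | inj₁ (_ , p≡q)  = cong s p≡q
    ... | inj₂ (_ , p≡q') =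
      contradiction (trans (sym even-p) (trans (cong (parity ∘ s) p≡q')
                      (trans (cong parity sq'≡) (parity-2c+1+2d c (x + b))))) λ ()

    odd-tail-on-progressions : ∀ {e} → (∀ i → parity (s i) ≡ 0ℙ → s i ≡ e) → ∀ d →
      OnProgression a e (2 * c + 1 + 2 * d) ⊎ OnProgression b e (2 * c + 1 + 2 * d)
    odd-tail-on-progressions {e} evens d with oddTerm d
    ... | n , sn≡ = subst (λ u → OnProgression a e u ⊎ OnProgression b e u) sn≡
        (odd-terms-on-progressions evens n (trans (cong parity sn≡) (parity-2c+1+2d c d)))

    even-term-∣4 : ∀ q → parity (s q) ≡ 0ℙ → s q ∣ 4
    even-term-∣4 q even-q =
      OnProgressions-∣4 (2 * c + 1)
        (odd-tail-on-progressions (λ i even-i → even-terms-equal i q even-i even-q))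

    b-even⇒b∣2 : parity b ≡ 0ℙ → b ∣ 2
    b-even⇒b∣2 even-b =
      OnProgression-∣ (on-a 0) (on-a 1) (cong (_+ 2) (sym (+-identityʳ (2 * c + 1))))
      where
      even-s1 : parity (s 1) ≡ 0ℙ
      even-s1 = trans (cong parity s1≡b) even-b
      on-a : ∀ d → OnProgression a b (2 * c + 1 + 2 * d)
      on-a d
        with odd-tail-on-progressions (λ i even-i → trans (even-terms-equal i 1 even-i even-s1) s1≡b) d
      ... | inj₁ on = on
      ... | inj₂ on =
        contradiction (trans (sym (parity-2c+1+2d c d)) (OnProgression-parity even-b even-b on)) λ ()

    a-even⇒double-b-uniqueRep : parity a ≡ 0ℙ → ∀ m → 1 ≤ m → UniqueRep s m (b + b)
    a-even⇒double-b-uniqueRep even-a m 1≤m = 1 , 1 , (≤-refl , 1≤m , cong₂ _+_ s1≡b s1≡b) , unique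
      where
      even-s0 : parity (s 0) ≡ 0ℙ
      even-s0 = trans (cong parity s0≡a) even-a
      even⇒≡a : ∀ i → parity (s i) ≡ 0ℙ → s i ≡ a
      even⇒≡a i even-i = trans (even-terms-equal i 0 even-i even-s0) s0≡a
      odd⇒≥b : ∀ i → parity (s i) ≡ 1ℙ → b ≤ s i
      odd⇒≥b zero    odd = contradiction (trans (sym even-s0) odd) λ ()
      odd⇒≥b (suc i) _   = subst (_≤ s (suc i)) s1≡b (mono-≤ (s≤s z≤n))
      unique : ∀ i j → IsRep s m (b + b) i j → (i ≡ 1) × (j ≡ 1)
      unique i j (_ , _ , sum)
        with parity (s i) in pi | parity-+≡0ℙ (s i) (s j) (trans (cong parity sum) (parity-double b))
      ... | 0ℙ | pi≡pj =
        contradiction (trans (cong₂ _+_ (sym (even⇒≡a i pi)) (sym (even⇒≡a j (sym pi≡pj)))) sum)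
                      (<⇒≢ (+-mono-< a<b a<b))
      ... | 1ℙ | pi≡pj =
        injective (trans (x+y≡n+n⇒x≡n b≤si b≤sj sum) (sym s1≡b)) ,
        injective (trans (x+y≡n+n⇒x≡n b≤sj b≤si (trans (+-comm (s j) (s i)) sum)) (sym s1≡b))
        where
        b≤si = odd⇒≥b i pi
        b≤sj = odd⇒≥b j (sym pi≡pj)

    a-even⇒double-b-term : parity a ≡ 0ℙ → ∃[ m ] (s (suc m) ≡ b + b)
    a-even⇒double-b-term even-a
      with crossing {b + b} 1 (subst (_< b + b) (sym s1≡b) (m<m+n b (<-trans 0<a a<b)))
    ... | m , 1≤m , sm<2b , 2b≤sm+1 = m , ≤-antisym sm+1≤2b 2b≤sm+1
      where
      sm+1≤2b : s (suc m) ≤ b + b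
      sm+1≤2b = ≮⇒≥ λ 2b<sm+1 →
        termMinimal m 1≤m (b + b) sm<2b 2b<sm+1 (a-even⇒double-b-uniqueRep even-a m 1≤m)

    -- Otherwise b + b would be a term, and an even term other than a.
    a-odd : parity a ≡ 1ℙ
    a-odd with parity a in pa
    ... | 1ℙ = refl
    ... | 0ℙ with a-even⇒double-b-term pa
    ...   | m , sm+1≡2b =
      contradiction (trans (sym s0≡a) (trans (even-terms-equal 0 (suc m) even-s0 even-sm+1) sm+1≡2b))
                    (<⇒≢ (<-≤-trans a<b (m≤m+n b b)))
      where
      even-s0 = trans (cong parity s0≡a) pa
      even-sm+1 = trans (cong parity sm+1≡2b) (parity-double b)

    initial-terms : (a ≡ 1 × b ≡ 2) ⊎ (a ≡ 1 × b ≡ 3)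
    initial-terms with parity b in pb
    ... | 0ℙ = inj₁ (0<a<b≤2 0<a a<b (∣⇒≤ (b-even⇒b∣2 pb)))
    ... | 1ℙ = inj₂ (odd-0<a<b≤3 0<a a<b b≤3 a-odd pb)
      where
      odd-initial : ∀ i → i ≤ 1 → parity (s i) ≡ 1ℙ
      odd-initial zero          _         = trans (cong parity s0≡a) a-odd
      odd-initial (suc zero)    _         = trans (cong parity s1≡b) pb
      odd-initial (suc (suc _)) (s≤s ())
      even-s2 : parity (s 2) ≡ 0ℙ
      even-s2 with termRep 1 ≤-refl
      ... | i , j , (i≤j , j≤1 , sum) , _ =
        trans (cong parity (sym sum))
          (parity-+-same (s i) (s j)
            (trans (odd-initial i (≤-trans i≤j j≤1)) (sym (odd-initial j j≤1))))
      b≤3 : b ≤ 3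
      b≤3 = ≤-pred (<-≤-trans (subst (_< s 2) s1≡b (increasing 1)) (∣⇒≤ (even-term-∣4 2 even-s2)))

theorem2p2 : (a b : ℕ) → 0 < a → a < b → (s : ℕ → ℕ) → IsV a b s →
    (∃[ c ] (∀ k → 2 * c + 1 ≤ 2 * k + 1 → IsTerm s (2 * k + 1))) →
    (∀ t → IsV 1 2 t → ∀ m → s m ≡ t m) ⊎ (∀ t → IsV 1 3 t → ∀ m → s m ≡ t m)
theorem2p2 a b 0<a a<b s hs (c , hc) with VSequence.OddTail.initial-terms 0<a a<b hs c hc
... | inj₁ (refl , refl) = inj₁ λ t → IsV-unique hs
... | inj₂ (refl , refl) = inj₂ λ t → IsV-unique hs
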